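{- Let $r\geq 4$ and let $M_r$ be the matrix indexed by subsets of $[r]$ with $M_r(S,T)=\binom{|S\cap T|}{2}+\binom{|\overline{S}\cap\overline{T}|}{2}$, $\overline{S}=[r]\setminus S$. Fix $U\subseteq[r]$ with $|U|<r-2$, and define $V\in\mathbb{R}^{\mathcal{P}([r])}$ by $V_T = (-1)^{|T|}$ if $U\subseteq T$ and $V_T=0$ otherwise. Then $V$ is an eigenvector of $M_r$ with eigenvalue $0$.
   Context: $\mathcal{P}([r])$ is the power set of $[r]=\{1,\ldots,r\}$. -}

module Defs where

open import Data.Nat using (ℕ; zero; suc)
open import Data.Nat.Combinatorics using (_C_)
open import Data.Bool using (Bool; true; false)
open import Data.Vec using (Vec; []; _∷_)
open import Data.List using (List; []; _∷_; map; _++_; foldr)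
open import Data.Integer using (ℤ; +_; -_; _+_; _*_; 0ℤ; 1ℤ)
open import Data.Fin.Subset using (Subset; _⊆_; _∩_; ∁; ∣_∣)
open import Relation.Nullary using (Dec; yes; no)

allSubsets : (r : ℕ) → List (Subset r)
allSubsets zero = [] ∷ []
allSubsets (suc r) = map (true ∷_) (allSubsets r) ++ map (false ∷_) (allSubsets r)

sumSubsets : (r : ℕ) → (Subset r → ℤ) → ℤ
sumSubsets r f = foldr (λ T acc → f T + acc) 0ℤ (allSubsets r)

M : (r : ℕ) → Subset r → Subset r → ℤ
M r S T = + ((∣ S ∩ T ∣ C 2) Data.Nat.+ (∣ ∁ S ∩ ∁ T ∣ C 2))

signℤ : ℕ → ℤ
signℤ zero = 1ℤ
signℤ (suc k) = - signℤ k

_⊆?_ : {r : ℕ} → (U T : Subset r) → Dec (U ⊆ T)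
_⊆?_ = Data.Fin.Subset.Properties._⊆?_
  where import Data.Fin.Subset.Properties

V : (r : ℕ) → Subset r → Subset r → ℤ
V r U T with U ⊆? T
... | yes _ = signℤ ∣ T ∣
... | no _ = 0ℤ

MV : (r : ℕ) → Subset r → Subset r → ℤ
MV r U S = sumSubsets r (λ T → M r S T * V r U T)

-- Read as a function of the indicator vector of T, M r S T is a polynomial of degree 2:
-- binomial coefficients C(·,2) of the counts |S ∩ T| and |S̄ ∩ T̄|, which are affine in the
-- coordinates. Pairing with V_U restricts each coordinate in U to 1 and takes a discrete
-- derivative in each coordinate outside U, so it annihilates every multilinear polynomial
-- of degree < |[r] ∖ U|, and |[r] ∖ U| ≥ 3 by hypothesis.
module Submission where

open import Defs
open import Data.Nat using (ℕ; _≤_; _<_; _∸_)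
open import Data.Integer using (ℤ; 0ℤ)
open import Data.Fin.Subset using (Subset; ∣_∣)
open import Data.Product using (_×_; ∃-syntax)
open import Relation.Binary.PropositionalEquality using (_≡_; _≢_)

open import Function using (_∘_)
open import Data.Unit using (⊤; tt)
open import Data.Product using (_,_)
open import Data.Bool using (true; false)
open import Data.Vec using ([]; _∷_)
open import Data.List using (List; []; _∷_; map; _++_; foldr)
open import Data.Nat using (zero; suc; pred) renaming (_+_ to _N+_)
import Data.Nat.Properties as ℕ
open import Data.Nat.Combinatorics using (_C_; nC1≡n; nCk+nC[k+1]≡[n+1]C[k+1])
open import Data.Integer using (+_; -_; _+_; _-_; _*_; 1ℤ)
import Data.Integer.Properties as ℤ
open import Data.Integer.Tactic.RingSolver using (solve-∀)
open import Data.Fin.Subset using (_∩_; ∁; _⊆_)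
open import Data.Fin.Subset.Properties using (⊆-refl; ∣∁p∣≡n∸∣p∣)
open import Relation.Nullary using (yes; no)
open import Relation.Binary.PropositionalEquality using (refl; sym; trans; cong; cong₂; subst; module ≡-Reasoning)
open import Data.Empty using (⊥-elim)

sumList : {A : Set} → (A → ℤ) → List A → ℤ
sumList f = foldr (λ x acc → f x + acc) 0ℤ

sumList-++ : {A : Set} (f : A → ℤ) (xs ys : List A) →
  sumList f (xs ++ ys) ≡ sumList f xs + sumList f ys
sumList-++ f [] ys = sym (ℤ.+-identityˡ _)
sumList-++ f (x ∷ xs) ys =
  trans (cong (_+_ (f x)) (sumList-++ f xs ys)) (sym (ℤ.+-assoc (f x) _ _))

sumList-map : {A B : Set} (f : B → ℤ) (g : A → B) (xs : List A) →
  sumList f (map g xs) ≡ sumList (f ∘ g) xs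
sumList-map f g [] = refl
sumList-map f g (x ∷ xs) = cong (_+_ (f (g x))) (sumList-map f g xs)

sumList-cong : {A : Set} {f g : A → ℤ} → (∀ x → f x ≡ g x) → (xs : List A) →
  sumList f xs ≡ sumList g xs
sumList-cong f≡g [] = refl
sumList-cong f≡g (x ∷ xs) = cong₂ _+_ (f≡g x) (sumList-cong f≡g xs)

sumList-+ : {A : Set} (f g : A → ℤ) (xs : List A) →
  sumList (λ x → f x + g x) xs ≡ sumList f xs + sumList g xs
sumList-+ f g [] = refl
sumList-+ f g (x ∷ xs) =
  trans (cong (_+_ (f x + g x)) (sumList-+ f g xs)) (interchange (f x) (g x) _ _)
  where
  interchange : ∀ a b c d → (a + b) + (c + d) ≡ (a + c) + (b + d)
  interchange = solve-∀

sumList-neg : {A : Set} (f : A → ℤ) (xs : List A) →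
  sumList (λ x → - f x) xs ≡ - sumList f xs
sumList-neg f [] = refl
sumList-neg f (x ∷ xs) =
  trans (cong (_+_ (- f x)) (sumList-neg f xs)) (sym (ℤ.neg-distrib-+ (f x) _))

sumSubsets-suc : ∀ r (f : Subset (suc r) → ℤ) →
  sumSubsets (suc r) f ≡ sumSubsets r (λ T → f (true ∷ T) + f (false ∷ T))
sumSubsets-suc r f = begin
  sumList f (map (true ∷_) (allSubsets r) ++ map (false ∷_) (allSubsets r))
    ≡⟨ sumList-++ f (map (true ∷_) (allSubsets r)) (map (false ∷_) (allSubsets r)) ⟩
  sumList f (map (true ∷_) (allSubsets r)) + sumList f (map (false ∷_) (allSubsets r))
    ≡⟨ cong₂ _+_ (sumList-map f _ (allSubsets r)) (sumList-map f _ (allSubsets r)) ⟩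
  sumList (f ∘ (true ∷_)) (allSubsets r) + sumList (f ∘ (false ∷_)) (allSubsets r)
    ≡⟨ sym (sumList-+ (f ∘ (true ∷_)) (f ∘ (false ∷_)) (allSubsets r)) ⟩
  sumSubsets r (λ T → f (true ∷ T) + f (false ∷ T)) ∎
  where open ≡-Reasoning

Δ : (ℕ → ℤ) → ℕ → ℤ
Δ g n = g (suc n) - g n

PolyDegree< : ℕ → (ℕ → ℤ) → Set
PolyDegree< zero g = ∀ n → g n ≡ 0ℤ
PolyDegree< (suc d) g = PolyDegree< d (Δ g)

PolyDegree<-cong : ∀ d {f g : ℕ → ℤ} → (∀ n → f n ≡ g n) → PolyDegree< d f → PolyDegree< d g
PolyDegree<-cong zero f≡g f0 n = trans (sym (f≡g n)) (f0 n)
PolyDegree<-cong (suc d) f≡g = PolyDegree<-cong d (λ n → cong₂ _-_ (f≡g (suc n)) (f≡g n))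

PolyDegree<-shift : ∀ d {g : ℕ → ℤ} → PolyDegree< d g → PolyDegree< d (g ∘ suc)
PolyDegree<-shift zero g0 n = g0 (suc n)
PolyDegree<-shift (suc d) = PolyDegree<-shift d

PolyDegree<-Δ : ∀ d {g : ℕ → ℤ} → PolyDegree< d g → PolyDegree< (pred d) (Δ g)
PolyDegree<-Δ zero g0 n = cong₂ _-_ (g0 (suc n)) (g0 n)
PolyDegree<-Δ (suc d) Δg = Δg

binomial₂ : ℕ → ℤ
binomial₂ n = + (n C 2)

PolyDegree<-binomial₂ : PolyDegree< 3 binomial₂
PolyDegree<-binomial₂ =
  PolyDegree<-cong 2 (sym ∘ Δ-binomial₂) (PolyDegree<-cong 1 (sym ∘ Δ-id) λ _ → refl)
  where
  Δ-id : ∀ n → Δ +_ n ≡ 1ℤ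
  Δ-id n = trans (cong (_- + n) (ℤ.pos-+ 1 n)) (cancel (+ n))
    where
    cancel : ∀ x → (1ℤ + x) - x ≡ 1ℤ
    cancel = solve-∀
  Δ-binomial₂ : ∀ n → Δ binomial₂ n ≡ + n
  Δ-binomial₂ n = begin
    + (suc n C 2) - + (n C 2)           ≡⟨ cong (λ m → + m - + (n C 2)) pascal ⟩
    + (n N+ n C 2) - + (n C 2)          ≡⟨ cong (_- + (n C 2)) (ℤ.pos-+ n (n C 2)) ⟩
    (+ n + + (n C 2)) - + (n C 2)       ≡⟨ cancel (+ n) (+ (n C 2)) ⟩
    + n ∎
    where
    open ≡-Reasoning
    pascal : suc n C 2 ≡ n N+ n C 2
    pascal = trans (sym (nCk+nC[k+1]≡[n+1]C[k+1] n 1)) (cong (_N+ n C 2) (nC1≡n n))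
    cancel : ∀ x y → (x + y) - y ≡ x
    cancel = solve-∀

∂ : ∀ {r} → (Subset (suc r) → ℤ) → Subset r → ℤ
∂ h T = h (true ∷ T) - h (false ∷ T)

-- h, as a multilinear polynomial in the indicator coordinates of T, has degree < d.
Degree< : ∀ {r} → ℕ → (Subset r → ℤ) → Set
Degree< {zero} zero h = h [] ≡ 0ℤ
Degree< {zero} (suc d) h = ⊤
Degree< {suc r} d h =
  Degree< d (h ∘ (true ∷_)) × Degree< d (h ∘ (false ∷_)) × Degree< (pred d) (∂ h)

Degree<-cong : ∀ {r} d {f g : Subset r → ℤ} → (∀ T → f T ≡ g T) → Degree< d f → Degree< d g
Degree<-cong {zero} zero f≡g f0 = trans (sym (f≡g [])) f0
Degree<-cong {zero} (suc d) f≡g _ = tt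
Degree<-cong {suc r} d f≡g (f₁ , f₀ , ∂f) =
  Degree<-cong d (f≡g ∘ (true ∷_)) f₁ ,
  Degree<-cong d (f≡g ∘ (false ∷_)) f₀ ,
  Degree<-cong (pred d) (λ T → cong₂ _-_ (f≡g (true ∷ T)) (f≡g (false ∷ T))) ∂f

Degree<-zero : ∀ {r} d → Degree< {r} d (λ _ → 0ℤ)
Degree<-zero {zero} zero = refl
Degree<-zero {zero} (suc d) = tt
Degree<-zero {suc r} d = Degree<-zero d , Degree<-zero d , Degree<-zero (pred d)

Degree<-neg : ∀ {r} d {f : Subset r → ℤ} → Degree< d f → Degree< d (λ T → - f T)
Degree<-neg {zero} zero f0 = cong -_ f0
Degree<-neg {zero} (suc d) _ = tt
Degree<-neg {suc r} d {f} (f₁ , f₀ , ∂f) =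
  Degree<-neg d f₁ , Degree<-neg d f₀ ,
  Degree<-cong (pred d) (λ T → neg-minus (f (true ∷ T)) (f (false ∷ T))) (Degree<-neg (pred d) ∂f)
  where
  neg-minus : ∀ a b → - (a - b) ≡ (- a) - (- b)
  neg-minus = solve-∀

Degree<-+ : ∀ {r} d {f g : Subset r → ℤ} → Degree< d f → Degree< d g → Degree< d (λ T → f T + g T)
Degree<-+ {zero} zero f0 g0 = cong₂ _+_ f0 g0
Degree<-+ {zero} (suc d) _ _ = tt
Degree<-+ {suc r} d {f} {g} (f₁ , f₀ , ∂f) (g₁ , g₀ , ∂g) =
  Degree<-+ d f₁ g₁ , Degree<-+ d f₀ g₀ ,
  Degree<-cong (pred d) (λ T → interchange (f (true ∷ T)) (g (true ∷ T)) (f (false ∷ T)) (g (false ∷ T)))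
    (Degree<-+ (pred d) ∂f ∂g)
  where
  interchange : ∀ a b c e → (a - c) + (b - e) ≡ (a + b) - (c + e)
  interchange = solve-∀

Degree<-∘∁ : ∀ {r} d {h : Subset r → ℤ} → Degree< d h → Degree< d (h ∘ ∁)
Degree<-∘∁ {zero} zero h0 = h0
Degree<-∘∁ {zero} (suc d) _ = tt
Degree<-∘∁ {suc r} d {h} (h₁ , h₀ , ∂h) =
  Degree<-∘∁ d h₀ , Degree<-∘∁ d h₁ ,
  Degree<-cong (pred d) (λ T → flip (h (true ∷ ∁ T)) (h (false ∷ ∁ T)))
    (Degree<-neg (pred d) (Degree<-∘∁ (pred d) ∂h))
  where
  flip : ∀ a b → - (a - b) ≡ b - a
  flip = solve-∀

Degree<-∘∣∩∣ : ∀ {r} d {g : ℕ → ℤ} → PolyDegree< d g → (S : Subset r) → Degree< d (λ T → g ∣ S ∩ T ∣)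
Degree<-∘∣∩∣ {zero} zero g0 [] = g0 0
Degree<-∘∣∩∣ {zero} (suc d) _ [] = tt
Degree<-∘∣∩∣ {suc r} d gd (true ∷ S) =
  Degree<-∘∣∩∣ d (PolyDegree<-shift d gd) S , Degree<-∘∣∩∣ d gd S ,
  Degree<-∘∣∩∣ (pred d) (PolyDegree<-Δ d gd) S
Degree<-∘∣∩∣ {suc r} d {g} gd (false ∷ S) =
  Degree<-∘∣∩∣ d gd S , Degree<-∘∣∩∣ d gd S ,
  Degree<-cong (pred d) (λ T → sym (ℤ.+-inverseʳ (g ∣ S ∩ T ∣))) (Degree<-zero (pred d))

Degree<-M : ∀ r (S : Subset r) → Degree< 3 (M r S)
Degree<-M r S =
  Degree<-cong 3 (λ T → sym (ℤ.pos-+ (∣ S ∩ T ∣ C 2) (∣ ∁ S ∩ ∁ T ∣ C 2)))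
    (Degree<-+ 3 (Degree<-∘∣∩∣ 3 {binomial₂} PolyDegree<-binomial₂ S)
                 (Degree<-∘∁ 3 (Degree<-∘∣∩∣ 3 {binomial₂} PolyDegree<-binomial₂ (∁ S))))

V-inside : ∀ {r} b (U T : Subset r) → V (suc r) (b ∷ U) (true ∷ T) ≡ - V r U T
V-inside true U T with U ⊆? T
... | yes _ = refl
... | no _ = refl
V-inside false U T with U ⊆? T
... | yes _ = refl
... | no _ = refl

V-outside : ∀ {r} (U T : Subset r) → V (suc r) (false ∷ U) (false ∷ T) ≡ V r U T
V-outside U T with U ⊆? T
... | yes _ = refl
... | no _ = refl

pairingV : ∀ {r} → (Subset r → ℤ) → Subset r → ℤ
pairingV {r} h U = sumSubsets r (λ T → h T * V r U T)

pairingV-inside : ∀ {r} (h : Subset (suc r) → ℤ) (U : Subset r) →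
  pairingV h (true ∷ U) ≡ - pairingV (h ∘ (true ∷_)) U
pairingV-inside {r} h U =
  trans (sumSubsets-suc r (λ T → h T * V (suc r) (true ∷ U) T))
    (trans (sumList-cong term (allSubsets r)) (sumList-neg (λ T → h (true ∷ T) * V r U T) (allSubsets r)))
  where
  simplify : ∀ a b v → a * - v + b * 0ℤ ≡ - (a * v)
  simplify = solve-∀
  -- V (suc r) (true ∷ U) (false ∷ T) computes to 0ℤ.
  term : ∀ T → h (true ∷ T) * V (suc r) (true ∷ U) (true ∷ T) + h (false ∷ T) * 0ℤ
             ≡ - (h (true ∷ T) * V r U T)
  term T = trans (cong (λ v → h (true ∷ T) * v + h (false ∷ T) * 0ℤ) (V-inside true U T))
                 (simplify (h (true ∷ T)) (h (false ∷ T)) (V r U T))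

pairingV-outside : ∀ {r} (h : Subset (suc r) → ℤ) (U : Subset r) →
  pairingV h (false ∷ U) ≡ - pairingV (∂ h) U
pairingV-outside {r} h U =
  trans (sumSubsets-suc r (λ T → h T * V (suc r) (false ∷ U) T))
    (trans (sumList-cong term (allSubsets r)) (sumList-neg (λ T → ∂ h T * V r U T) (allSubsets r)))
  where
  simplify : ∀ a b v → a * - v + b * v ≡ - ((a - b) * v)
  simplify = solve-∀
  term : ∀ T → h (true ∷ T) * V (suc r) (false ∷ U) (true ∷ T) + h (false ∷ T) * V (suc r) (false ∷ U) (false ∷ T)
             ≡ - (∂ h T * V r U T)
  term T = trans (cong₂ (λ v w → h (true ∷ T) * v + h (false ∷ T) * w) (V-inside false U T) (V-outside U T))
                 (simplify (h (true ∷ T)) (h (false ∷ T)) (V r U T))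

pairingV-Degree< : ∀ {r} d {h : Subset r → ℤ} (U : Subset r) → Degree< d h → d ≤ ∣ ∁ U ∣ →
  pairingV h U ≡ 0ℤ
pairingV-Degree< {zero} zero [] h0 _ =
  cong (λ x → x * V 0 [] [] + 0ℤ) h0
pairingV-Degree< {zero} (suc d) [] _ ()
pairingV-Degree< {suc r} d {h} (true ∷ U) (h₁ , _ , _) d≤ =
  trans (pairingV-inside h U) (cong -_ (pairingV-Degree< d U h₁ d≤))
pairingV-Degree< {suc r} d {h} (false ∷ U) (_ , _ , ∂h) d≤ =
  trans (pairingV-outside h U) (cong -_ (pairingV-Degree< (pred d) U ∂h (ℕ.pred-mono-≤ d≤)))

signℤ≢0 : ∀ k → signℤ k ≢ 0ℤ
signℤ≢0 zero ()
signℤ≢0 (suc k) sk≡0 = signℤ≢0 k (ℤ.neg-injective sk≡0)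

V-⊆ : ∀ {r} {U T : Subset r} → U ⊆ T → V r U T ≡ signℤ ∣ T ∣
V-⊆ {U = U} {T} U⊆T with U ⊆? T
... | yes _ = refl
... | no U⊈T = ⊥-elim (U⊈T U⊆T)

3≤∣∁U∣ : ∀ {r} (U : Subset r) → 4 ≤ r → ∣ U ∣ < r ∸ 2 → 3 ≤ ∣ ∁ U ∣
3≤∣∁U∣ {r} U 4≤r ∣U∣<r-2 = subst (3 ≤_) (sym (∣∁p∣≡n∸∣p∣ U)) (ℕ.m+n≤o⇒m≤o∸n 3 3+∣U∣≤r)
  where
  3+∣U∣≤r : 3 N+ ∣ U ∣ ≤ r
  3+∣U∣≤r = subst (_≤ r) (ℕ.+-comm (suc ∣ U ∣) 2)
              (ℕ.m≤o∸n⇒m+n≤o (suc ∣ U ∣) (ℕ.m+n≤o⇒n≤o 2 4≤r) ∣U∣<r-2)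

proposition3 : (r : ℕ) → 4 ≤ r → (U : Subset r) → ∣ U ∣ < r ∸ 2 →
    (∃[ T ] V r U T ≢ 0ℤ) × (∀ S → MV r U S ≡ 0ℤ)
proposition3 r 4≤r U ∣U∣<r-2 =
  (U , λ V≡0 → signℤ≢0 ∣ U ∣ (trans (sym (V-⊆ {U = U} ⊆-refl)) V≡0)) ,
  λ S → pairingV-Degree< 3 U (Degree<-M r S) (3≤∣∁U∣ U 4≤r ∣U∣<r-2)
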